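{- Let $F$ be a graph and $d\geq 1$ an integer. For each parameter $p\in\{\text{treedepth},\text{pathwidth},\text{treewidth}\}$, the class of $F$-free graphs of diameter at most $d$ has bounded $p$ if and only if either $d=1$ and $F$ is a complete graph, or $d\geq 2$ and $F\in\{K_1,K_2\}$.
   Context: All graphs are finite, simple and undirected. A graph $G$ is $F$-free if it contains no induced subgraph isomorphic to $F$. The diameter of $G$ is the maximum distance between two vertices (infinite if disconnected). Treedepth, pathwidth and treewidth are the standard graph width parameters; a class has bounded $p$ if some constant bounds $p$ on all graphs of the class. -}

module Defs where

open import Data.Nat using (ℕ; zero; suc; _≤_; _<_; _+_)
open import Data.Fin using (Fin; zero; suc; fromℕ; inject₁)
import Data.Fin as Fin
open import Data.Fin.Subset using (Subset; _∈_; ∣_∣)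
open import Data.Bool using (Bool; true; false)
open import Data.Maybe using (Maybe; just; nothing)
open import Data.Product using (Σ; ∃; ∃-syntax; _×_; _,_)
open import Data.Sum using (_⊎_)
open import Data.Empty using (⊥)
open import Relation.Nullary using (¬_)
open import Relation.Binary.PropositionalEquality using (_≡_; _≢_)
open import Function.Definitions using (Injective)

record Graph (n : ℕ) : Set where
  field
    adj    : Fin n → Fin n → Bool
    sym    : ∀ i j → adj i j ≡ adj j i
    irrefl : ∀ i → adj i i ≡ false

open Graph public

Edge : ∀ {n} → Graph n → Fin n → Fin n → Set
Edge G u v = adj G u v ≡ true

InducedSub : ∀ {m n} → Graph m → Graph n → Set
InducedSub {m} {n} F G =
  Σ (Fin m → Fin n) λ f → Injective _≡_ _≡_ f × (∀ i j → adj F i j ≡ adj G (f i) (f j))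

Free : ∀ {m n} → Graph m → Graph n → Set
Free F G = ¬ InducedSub F G

IsComplete : ∀ {m} → Graph m → Set
IsComplete {m} F = ∀ (i j : Fin m) → i ≢ j → Edge F i j

Walk : ∀ {n} → Graph n → (k : ℕ) → Fin n → Fin n → Set
Walk {n} G k u v =
  Σ (Fin (suc k) → Fin n) λ w →
    (w zero ≡ u) × (w (fromℕ k) ≡ v) × (∀ (i : Fin k) → Edge G (w (inject₁ i)) (w (suc i)))

WalkIn : ∀ {n} → Graph n → (Fin n → Set) → (k : ℕ) → Fin n → Fin n → Set
WalkIn {n} G S k u v =
  Σ (Fin (suc k) → Fin n) λ w →
    (w zero ≡ u) × (w (fromℕ k) ≡ v) × (∀ (i : Fin k) → Edge G (w (inject₁ i)) (w (suc i)))
    × (∀ (i : Fin (suc k)) → S (w i))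

DistLe : ∀ {n} → Graph n → Fin n → Fin n → ℕ → Set
DistLe G u v d = ∃[ k ] (k ≤ d × Walk G k u v)

-- diam(G) ≤ d  (a disconnected graph has infinite diameter)
DiamLe : ∀ {n} → Graph n → ℕ → Set
DiamLe {n} G d = ∀ (u v : Fin n) → DistLe G u v d

Connected : ∀ {n} → Graph n → Set
Connected {n} G = ∀ (u v : Fin n) → ∃[ k ] Walk G k u v

ConnectedSet : ∀ {n} → Graph n → (Fin n → Set) → Set
ConnectedSet {n} G S = ∀ (u v : Fin n) → S u → S v → ∃[ k ] WalkIn G S k u v

Cycle : ∀ {n} → Graph n → Set
Cycle {n} G =
  Σ ℕ λ k → Σ (Fin (suc (suc (suc k))) → Fin n) λ c →
    Injective _≡_ _≡_ c
    × (∀ (i : Fin (suc (suc k))) → Edge G (c (inject₁ i)) (c (suc i)))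
    × Edge G (c (fromℕ (suc (suc k)))) (c zero)

IsTree : ∀ {r} → Graph r → Set
IsTree {r} T = (1 ≤ r) × Connected T × ¬ Cycle T

TreeDecomp : ∀ {n} → Graph n → ℕ → Set
TreeDecomp {n} G c =
  Σ ℕ λ r → Σ (Graph r) λ T → Σ (Fin r → Subset n) λ bag →
    IsTree T
    × (∀ (v : Fin n) → ∃[ t ] (v ∈ bag t))
    × (∀ (u v : Fin n) → Edge G u v → ∃[ t ] (u ∈ bag t × v ∈ bag t))
    × (∀ (v : Fin n) → ConnectedSet T (λ t → v ∈ bag t))
    × (∀ (t : Fin r) → ∣ bag t ∣ ≤ suc c)

TwLe : ∀ {n} → Graph n → ℕ → Set
TwLe = TreeDecomp

PwLe : ∀ {n} → Graph n → ℕ → Set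
PwLe {n} G c =
  Σ ℕ λ r → Σ (Fin r → Subset n) λ bag →
    (∀ (v : Fin n) → ∃[ t ] (v ∈ bag t))
    × (∀ (u v : Fin n) → Edge G u v → ∃[ t ] (u ∈ bag t × v ∈ bag t))
    × (∀ (v : Fin n) (i j k : Fin r) → i Fin.≤ j → j Fin.≤ k → v ∈ bag i → v ∈ bag k → v ∈ bag j)
    × (∀ (t : Fin r) → ∣ bag t ∣ ≤ suc c)

-- Treedepth: td(G) ≤ c iff there is a rooted forest on V(G) of height
-- at most c (height counted in vertices, roots have depth 1) such that
-- for every edge uv, one of u, v is an ancestor of the other.
-- The forest is given by a parent function; the depth function certifies
-- acyclicity.

data Ancestor {n : ℕ} (par : Fin n → Maybe (Fin n)) : Fin n → Fin n → Set where
  parent : ∀ {u v} → par v ≡ just u → Ancestor par u v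
  step   : ∀ {u w v} → par v ≡ just w → Ancestor par u w → Ancestor par u v

TdLe : ∀ {n} → Graph n → ℕ → Set
TdLe {n} G c =
  Σ (Fin n → Maybe (Fin n)) λ par → Σ (Fin n → ℕ) λ depth →
    (∀ v → par v ≡ nothing → depth v ≡ 1)
    × (∀ u v → par v ≡ just u → depth v ≡ suc (depth u))
    × (∀ v → 1 ≤ depth v × depth v ≤ c)
    × (∀ u v → Edge G u v → Ancestor par u v ⊎ Ancestor par v u)

data Param : Set where
  treedepth pathwidth treewidth : Param

ParamLe : Param → ∀ {n} → Graph n → ℕ → Set
ParamLe treedepth G c = TdLe G c
ParamLe pathwidth G c = PwLe G c
ParamLe treewidth G c = TwLe G c

BoundedOnFreeDiam : Param → ∀ {m} → Graph m → ℕ → Set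
BoundedOnFreeDiam p F d =
  ∃[ c ] (∀ (n : ℕ) (G : Graph n) → Free F G → DiamLe G d → ParamLe p G c)

-- Upper bound: in each allowed case every graph of the class is complete. Diameter 1 forces this,
-- and for F ∈ {K₁, K₂} a connected F-free graph has no edge, hence at most one vertex. A complete
-- F-free graph has fewer than |F| vertices, and a graph on n vertices has all three parameters at
-- most n.
--
-- Lower bound: every decomposition of width c has a vertex of degree at most c. For treedepth take
-- a deepest vertex; for path and tree decompositions peel off leaf bags until one contains a closed
-- neighbourhood. If F is not complete, the complete graphs are F-free of diameter 1; if F is a
-- complete graph on at least 3 vertices, the triangle-free graphs K_{N,N} have diameter 2. Both
-- families have unbounded minimum degree.

{-# OPTIONS --safe #-}
module Submission where

open import Defs
open import Data.Bool using (Bool; true; false; not; _xor_)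
import Data.Bool as Bool
import Data.Bool.Properties as BoolP
open import Data.Empty using (⊥-elim)
open import Data.Fin as Fin
  using (Fin; zero; suc; toℕ; fromℕ; fromℕ<; inject₁; inject≤; punchIn; punchOut; splitAt; _↑ˡ_; _↑ʳ_;
         _≟_)
import Data.Fin.Properties as FinP
open import Data.Fin.Subset using (Subset; _∈_; _∉_; _⊆_; ∣_∣; ⊤; _-_)
open import Data.Fin.Subset.Properties
  using (_∈?_; ∈⊤; ∣⊤∣≡n; x∈p∧x≢y⇒x∈p-y; x∈p⇒∣p-x∣<∣p∣)
open import Data.Maybe using (Maybe; just; nothing)
import Data.Maybe.Properties as MaybeP
open import Data.Nat using (ℕ; zero; suc; _+_; _≤_; _<_; z≤n; s≤s)
import Data.Nat.Properties as ℕP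
open import Data.Product using (Σ; ∃-syntax; _×_; _,_; proj₂)
open import Data.Sum using (_⊎_; inj₁; inj₂; [_,_]′)
open import Data.Vec.Functional using (_∷_)
open import Function using (_∘_; id; const; case_of_)
open import Function.Bundles using (_⇔_; mk⇔)
open import Function.Definitions using (Injective)
open import Relation.Binary.Definitions using (tri<; tri≈; tri>)
open import Relation.Binary.PropositionalEquality as ≡ using (_≡_; _≢_; refl)
open import Relation.Nullary using (¬_; Dec; yes; no; does; ¬?; _×-dec_; _→-dec_)
open import Relation.Nullary.Decidable using (dec-true; dec-false; decidable-stable)

private
  variable
    m n r : ℕ

Edge-irrefl : (G : Graph n) {u v : Fin n} → Edge G u v → u ≢ v
Edge-irrefl G {u} e refl with ≡.trans (≡.sym e) (irrefl G u)
... | ()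

Edge-sym : (G : Graph n) {u v : Fin n} → Edge G u v → Edge G v u
Edge-sym G {u} {v} e = ≡.trans (sym G v u) e

walk-refl : (G : Graph n) (u : Fin n) → Walk G 0 u u
walk-refl G u = const u , refl , refl , λ ()

edge⇒walk : (G : Graph n) {u v : Fin n} → Edge G u v → Walk G 1 u v
edge⇒walk G {u} {v} e = (u ∷ const v) , refl , refl , λ { zero → e }

edges⇒walk : (G : Graph n) {u w v : Fin n} → Edge G u w → Edge G w v → Walk G 2 u v
edges⇒walk G {u} {w} {v} e e′ = (u ∷ w ∷ const v) , refl , refl , λ { zero → e ; (suc zero) → e′ }

DiamLe-mono : (G : Graph n) {d d′ : ℕ} → d ≤ d′ → DiamLe G d → DiamLe G d′
DiamLe-mono G d≤d′ diam u v with diam u v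
... | k , k≤d , walk = k , ℕP.≤-trans k≤d d≤d′ , walk

complete⇒DiamLe1 : (G : Graph n) → IsComplete G → DiamLe G 1
complete⇒DiamLe1 G complete u v with u ≟ v
... | yes refl = 0 , z≤n , walk-refl G u
... | no u≢v = 1 , ℕP.≤-refl , edge⇒walk G (complete u v u≢v)

DiamLe1⇒complete : (G : Graph n) → DiamLe G 1 → IsComplete G
DiamLe1⇒complete G diam u v u≢v with diam u v
... | zero , _ , w , refl , refl , _ = ⊥-elim (u≢v refl)
... | suc zero , _ , w , refl , refl , edges = edges zero
... | suc (suc _) , s≤s () , _

distinct⇒edge : (G : Graph n) {d : ℕ} → DiamLe G d → {u v : Fin n} → u ≢ v → ∃[ x ] ∃[ y ] Edge G x y
distinct⇒edge G diam {u} {v} u≢v with diam u v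
... | zero , _ , w , refl , refl , _ = ⊥-elim (u≢v refl)
... | suc _ , _ , w , _ , _ , edges = w zero , w (suc zero) , edges zero

InducedSub-complete : {F : Graph m} {G : Graph n} → InducedSub F G → IsComplete G → IsComplete F
InducedSub-complete (f , f-inj , f-adj) complete i j i≢j =
  ≡.trans (f-adj i j) (complete (f i) (f j) (i≢j ∘ f-inj))

clique⇒InducedSub : {F : Graph m} (G : Graph n) → IsComplete F →
  (f : Fin m → Fin n) → Injective _≡_ _≡_ f → (∀ i j → i ≢ j → Edge G (f i) (f j)) → InducedSub F G
clique⇒InducedSub {F = F} G complete f f-inj clique = f , f-inj , f-adj
  where
  f-adj : ∀ i j → adj F i j ≡ adj G (f i) (f j)
  f-adj i j with i ≟ j
  ... | yes refl = ≡.trans (irrefl F i) (≡.sym (irrefl G (f i)))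
  ... | no i≢j = ≡.trans (complete i j i≢j) (≡.sym (clique i j i≢j))

edge⇒InducedSub : {F : Graph m} (G : Graph n) → IsComplete F → m ≤ 2 →
  {x y : Fin n} → Edge G x y → InducedSub F G
edge⇒InducedSub {F = F} G complete m≤2 {x} {y} e =
  clique⇒InducedSub {F = F} G complete (pair ∘ λ i → inject≤ i m≤2)
    (λ eq → FinP.inject≤-injective m≤2 m≤2 _ _ (pair-inj eq))
    (λ i j i≢j → pair-clique (i≢j ∘ FinP.inject≤-injective m≤2 m≤2 i j))
  where
  pair : Fin 2 → Fin _
  pair = x ∷ const y
  pair-inj : Injective _≡_ _≡_ pair
  pair-inj {zero} {zero} _ = refl
  pair-inj {zero} {suc zero} x≡y = ⊥-elim (Edge-irrefl G e x≡y)
  pair-inj {suc zero} {zero} y≡x = ⊥-elim (Edge-irrefl G e (≡.sym y≡x))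
  pair-inj {suc zero} {suc zero} _ = refl
  pair-clique : ∀ {i j} → i ≢ j → Edge G (pair i) (pair j)
  pair-clique {zero} {zero} 0≢0 = ⊥-elim (0≢0 refl)
  pair-clique {zero} {suc zero} _ = e
  pair-clique {suc zero} {zero} _ = Edge-sym G e
  pair-clique {suc zero} {suc zero} 1≢1 = ⊥-elim (1≢1 refl)

complete-free⇒order< : {F : Graph m} (G : Graph n) → IsComplete F → IsComplete G → Free F G → n < m
complete-free⇒order< {m = m} {n = n} {F} G F-complete G-complete free with m ℕP.≤? n
... | no m≰n = ℕP.≰⇒> m≰n
... | yes m≤n = ⊥-elim (free (clique⇒InducedSub {F = F} G F-complete (λ i → inject≤ i m≤n)
        (λ {i} {j} → FinP.inject≤-injective m≤n m≤n i j)
        (λ i j i≢j → G-complete _ _ (i≢j ∘ FinP.inject≤-injective m≤n m≤n i j))))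

-- Complete graphs and complete bipartite graphs

K : ∀ n → Graph n
K n = record
  { adj = λ x y → not (does (x ≟ y))
  ; sym = K-sym
  ; irrefl = λ x → ≡.cong not (dec-true (x ≟ x) refl)
  }
  where
  K-sym : ∀ (x y : Fin n) → not (does (x ≟ y)) ≡ not (does (y ≟ x))
  K-sym x y with x ≟ y | y ≟ x
  ... | yes _ | yes _ = refl
  ... | no _ | no _ = refl
  ... | yes x≡y | no y≢x = ⊥-elim (y≢x (≡.sym x≡y))
  ... | no x≢y | yes y≡x = ⊥-elim (x≢y (≡.sym y≡x))

K-complete : IsComplete (K n)
K-complete x y x≢y = ≡.cong not (dec-false (x ≟ y) x≢y)

isLeft : ∀ N → Fin (N + N) → Bool
isLeft N x = [ const true , const false ]′ (splitAt N x)

isLeft-↑ˡ : ∀ {N} (i : Fin N) → isLeft N (i ↑ˡ N) ≡ true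
isLeft-↑ˡ {N} i rewrite FinP.splitAt-↑ˡ N i N = refl

isLeft-↑ʳ : ∀ {N} (j : Fin N) → isLeft N (N ↑ʳ j) ≡ false
isLeft-↑ʳ {N} j rewrite FinP.splitAt-↑ʳ N N j = refl

KB : ∀ N → Graph (N + N)
KB N = record
  { adj = λ x y → isLeft N x xor isLeft N y
  ; sym = λ x y → BoolP.xor-comm (isLeft N x) (isLeft N y)
  ; irrefl = λ x → BoolP.xor-same (isLeft N x)
  }

KB-edge : ∀ N {x y} → isLeft N x ≢ isLeft N y → Edge (KB N) x y
KB-edge N {x} {y} sides with isLeft N x | isLeft N y
... | true | false = refl
... | false | true = refl
... | true | true = ⊥-elim (sides refl)
... | false | false = ⊥-elim (sides refl)

KB-edge⁻ : ∀ N {x y} → Edge (KB N) x y → isLeft N x ≢ isLeft N y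
KB-edge⁻ N {x} e same
  with ≡.trans (≡.sym e) (≡.trans (≡.cong (isLeft N x xor_) (≡.sym same)) (BoolP.xor-same (isLeft N x)))
... | ()

KB-triangle-free : ∀ N {x y z} → Edge (KB N) x y → Edge (KB N) y z → ¬ Edge (KB N) x z
KB-triangle-free N xy yz xz =
  KB-edge⁻ N xz (≡.trans (BoolP.¬-not (KB-edge⁻ N xy))
                         (≡.sym (BoolP.¬-not (KB-edge⁻ N (Edge-sym (KB N) yz)))))

KB-opposite : ∀ N (x : Fin (suc N + suc N)) → ∃[ w ] isLeft (suc N) x ≢ isLeft (suc N) w
KB-opposite N x with isLeft (suc N) x
... | true  = suc N ↑ʳ zero , λ eq → case ≡.trans eq (isLeft-↑ʳ {suc N} zero) of λ ()
... | false = zero ↑ˡ suc N , λ eq → case ≡.trans eq (isLeft-↑ˡ {suc N} zero) of λ ()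

KB-DiamLe2 : ∀ N → DiamLe (KB (suc N)) 2
KB-DiamLe2 N u v with isLeft (suc N) u Bool.≟ isLeft (suc N) v | KB-opposite N u
... | no sides | _ = 1 , s≤s z≤n , edge⇒walk (KB (suc N)) (KB-edge (suc N) {u} {v} sides)
... | yes same | w , u≁w = 2 , ℕP.≤-refl , edges⇒walk (KB (suc N)) {w = w} (KB-edge (suc N) {u} {w} u≁w)
                             (KB-edge (suc N) {w} {v} (λ w≡v → u≁w (≡.trans same (≡.sym w≡v))))

KB-free : ∀ N {F : Graph m} → IsComplete F → 3 ≤ m → Free F (KB N)
KB-free N complete (s≤s (s≤s (s≤s _))) (f , _ , f-adj) =
  KB-triangle-free N {f zero} {f (suc zero)} {f (suc (suc zero))}
    (edge zero (suc zero) λ ()) (edge (suc zero) (suc (suc zero)) λ ()) (edge zero (suc (suc zero)) λ ())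
  where
  edge : ∀ i j → i ≢ j → Edge (KB N) (f i) (f j)
  edge i j i≢j = ≡.trans (≡.sym (f-adj i j)) (complete i j i≢j)

Neighbours : Graph n → Fin n → ℕ → Set
Neighbours {n} G v a = Σ (Fin a → Fin n) λ g → Injective _≡_ _≡_ g × (∀ i → Edge G (g i) v)

DegreeLe : Graph n → Fin n → ℕ → Set
DegreeLe G v c = ∀ {a} → Neighbours G v a → a ≤ c

K-neighbours : ∀ a (v : Fin (suc a)) → Neighbours (K (suc a)) v a
K-neighbours a v = punchIn v , FinP.punchIn-injective v _ _ , λ i → K-complete _ v (FinP.punchInᵢ≢i v i)

KB-neighbours : ∀ N (v : Fin (N + N)) → Neighbours (KB N) v N
KB-neighbours N v = neighbours (isLeft N v) refl
  where
  neighbours : ∀ b → isLeft N v ≡ b → Neighbours (KB N) v N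
  neighbours true side = (N ↑ʳ_) , FinP.↑ʳ-injective N _ _ ,
    λ j → KB-edge N {N ↑ʳ j} {v} λ eq → case ≡.trans (≡.sym (isLeft-↑ʳ j)) (≡.trans eq side) of λ ()
  neighbours false side = (_↑ˡ N) , FinP.↑ˡ-injective N _ _ ,
    λ i → KB-edge N {i ↑ˡ N} {v} λ eq → case ≡.trans (≡.sym (isLeft-↑ˡ i)) (≡.trans eq side) of λ ()

injective⇒≤∣p∣ : ∀ {k} {p : Subset n} (f : Fin k → Fin n) →
  Injective _≡_ _≡_ f → (∀ i → f i ∈ p) → k ≤ ∣ p ∣
injective⇒≤∣p∣ {k = zero} f _ _ = z≤n
injective⇒≤∣p∣ {k = suc k} {p} f f-inj f∈p =
  ℕP.≤-trans (s≤s (injective⇒≤∣p∣ (f ∘ suc) (FinP.suc-injective ∘ f-inj) tail∈))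
             (x∈p⇒∣p-x∣<∣p∣ (f∈p zero))
  where
  tail∈ : ∀ i → f (suc i) ∈ p - f zero
  tail∈ i = x∈p∧x≢y⇒x∈p-y (f∈p (suc i)) (FinP.0≢1+n ∘ f-inj ∘ ≡.sym)

closedNbhd⇒DegreeLe : (G : Graph n) {c : ℕ} {v : Fin n} {p : Subset n} →
  v ∈ p → (∀ u → Edge G u v → u ∈ p) → ∣ p ∣ ≤ suc c → DegreeLe G v c
closedNbhd⇒DegreeLe G {v = v} {p} v∈p nbhd⊆p ∣p∣≤1+c {a} (g , g-inj , g-adj) =
  ℕP.≤-pred (ℕP.≤-trans (s≤s a≤∣p-v∣) (ℕP.≤-trans (x∈p⇒∣p-x∣<∣p∣ v∈p) ∣p∣≤1+c))
  where
  a≤∣p-v∣ : a ≤ ∣ p - v ∣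
  a≤∣p-v∣ = injective⇒≤∣p∣ g g-inj λ i →
    x∈p∧x≢y⇒x∈p-y (nbhd⊆p _ (g-adj i)) (Edge-irrefl G (g-adj i))

-- Trivial decompositions

chainParent : Fin n → Maybe (Fin n)
chainParent zero    = nothing
chainParent (suc i) = just (inject₁ i)

chain-ancestor : ∀ k {u v : Fin n} → toℕ v ≡ suc (k + toℕ u) → Ancestor chainParent u v
chain-ancestor k {v = zero} ()
chain-ancestor zero {u} {suc i} eq =
  parent (≡.cong just (FinP.toℕ-injective (≡.trans (FinP.toℕ-inject₁ i) (ℕP.suc-injective eq))))
chain-ancestor (suc k) {v = suc i} eq =
  step refl (chain-ancestor k (≡.trans (FinP.toℕ-inject₁ i) (ℕP.suc-injective eq)))

<⇒chain-ancestor : {u v : Fin n} → u Fin.< v → Ancestor chainParent u v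
<⇒chain-ancestor {u = u} u<v with ℕP.m≤n⇒∃[o]m+o≡n u<v
... | k , 1+u+k≡v = chain-ancestor k (≡.trans (≡.sym 1+u+k≡v) (≡.cong suc (ℕP.+-comm (toℕ u) k)))

TdLe-order : (G : Graph n) {c : ℕ} → n ≤ c → TdLe G c
TdLe-order {n} G n≤c = chainParent , suc ∘ toℕ , root , child , bounds , comparable
  where
  root : ∀ v → chainParent v ≡ nothing → suc (toℕ v) ≡ 1
  root zero _ = refl
  child : ∀ u v → chainParent v ≡ just u → suc (toℕ v) ≡ suc (suc (toℕ u))
  child u (suc i) refl = ≡.cong (λ k → suc (suc k)) (≡.sym (FinP.toℕ-inject₁ i))
  bounds : ∀ v → 1 ≤ suc (toℕ v) × suc (toℕ v) ≤ _
  bounds v = s≤s z≤n , ℕP.≤-trans (FinP.toℕ<n v) n≤c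
  comparable : ∀ u v → Edge G u v → Ancestor chainParent u v ⊎ Ancestor chainParent v u
  comparable u v e with FinP.<-cmp u v
  ... | tri< u<v _ _ = inj₁ (<⇒chain-ancestor u<v)
  ... | tri≈ _ u≡v _ = ⊥-elim (Edge-irrefl G e u≡v)
  ... | tri> _ _ v<u = inj₂ (<⇒chain-ancestor v<u)

∣⊤∣≤1+c : ∀ {c} → n ≤ c → ∣ ⊤ {n} ∣ ≤ suc c
∣⊤∣≤1+c {n} n≤c = ℕP.≤-trans (ℕP.≤-reflexive (∣⊤∣≡n n)) (ℕP.m≤n⇒m≤1+n n≤c)

PwLe-order : (G : Graph n) {c : ℕ} → n ≤ c → PwLe G c
PwLe-order G n≤c =
  1 , const ⊤ , (λ _ → zero , ∈⊤) , (λ _ _ _ → zero , ∈⊤ , ∈⊤) , (λ _ _ _ _ _ _ _ _ → ∈⊤) , λ _ → ∣⊤∣≤1+c n≤c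

K1-tree : IsTree (K 1)
K1-tree = s≤s z≤n , (λ { zero zero → 0 , walk-refl (K 1) zero }) , acyclic
  where
  acyclic : ¬ Cycle (K 1)
  acyclic (_ , _ , c-inj , _) with FinP.injective⇒≤ c-inj
  ... | s≤s ()

TwLe-order : (G : Graph n) {c : ℕ} → n ≤ c → TwLe G c
TwLe-order G n≤c =
  1 , K 1 , const ⊤ , K1-tree , (λ _ → zero , ∈⊤) , (λ _ _ _ → zero , ∈⊤ , ∈⊤) , (λ _ → singleton-connected) ,
  λ _ → ∣⊤∣≤1+c n≤c
  where
  singleton-connected : ∀ {S} → ConnectedSet (K 1) S
  singleton-connected zero zero s _ = 0 , const zero , refl , refl , (λ ()) , λ { zero → s }

ParamLe-order : ∀ p (G : Graph n) {c : ℕ} → n ≤ c → ParamLe p G c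
ParamLe-order treedepth = TdLe-order
ParamLe-order pathwidth = PwLe-order
ParamLe-order treewidth = TwLe-order

-- A vertex of small degree in every decomposition

module _ {n} {par : Fin n → Maybe (Fin n)} {depth : Fin n → ℕ}
         (depth-child : ∀ u v → par v ≡ just u → depth v ≡ suc (depth u)) where

  Ancestor⇒depth< : ∀ {u v} → Ancestor par u v → depth u < depth v
  Ancestor⇒depth< (parent p)   = ℕP.≤-reflexive (≡.sym (depth-child _ _ p))
  Ancestor⇒depth< (step p u<w) =
    ℕP.<-trans (Ancestor⇒depth< u<w) (ℕP.≤-reflexive (≡.sym (depth-child _ _ p)))

  Ancestor-depth-injective : ∀ {u u′ v} →
    Ancestor par u v → Ancestor par u′ v → depth u ≡ depth u′ → u ≡ u′
  Ancestor-depth-injective (parent p) (parent p′) _ = MaybeP.just-injective (≡.trans (≡.sym p) p′)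
  Ancestor-depth-injective (parent p) (step p′ a′) d with MaybeP.just-injective (≡.trans (≡.sym p) p′)
  ... | refl = ⊥-elim (ℕP.<-irrefl (≡.sym d) (Ancestor⇒depth< a′))
  Ancestor-depth-injective (step p a) (parent p′) d with MaybeP.just-injective (≡.trans (≡.sym p) p′)
  ... | refl = ⊥-elim (ℕP.<-irrefl d (Ancestor⇒depth< a))
  Ancestor-depth-injective (step p a) (step p′ a′) d with MaybeP.just-injective (≡.trans (≡.sym p) p′)
  ... | refl = Ancestor-depth-injective a a′ d

argmax : (f : Fin (suc n) → ℕ) → ∃[ v ] (∀ u → f u ≤ f v)
argmax {zero} f = zero , λ { zero → ℕP.≤-refl }
argmax {suc n} f with argmax (f ∘ suc)
... | v , f∘suc≤ with f zero ℕP.≤? f (suc v)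
...   | yes f0≤ = suc v , λ { zero → f0≤ ; (suc u) → f∘suc≤ u }
...   | no f0≰ = zero , λ { zero → ℕP.≤-refl ; (suc u) → ℕP.≤-trans (f∘suc≤ u) (ℕP.≰⇒≥ f0≰) }

-- All neighbours of a deepest vertex are its ancestors, which have distinct depths below c.
TdLe⇒DegreeLe : (G : Graph (suc n)) {c : ℕ} → TdLe G c → ∃[ v ] DegreeLe G v c
TdLe⇒DegreeLe G {c} (par , depth , _ , depth-child , bounds , comparable) with argmax depth
... | v , deepest = v , λ (g , g-inj , g-adj) →
  FinP.injective⇒≤ {f = λ i → fromℕ< (depth<c (g-adj i))} λ {i} {j} eq →
    g-inj (Ancestor-depth-injective depth-child (ancestor (g-adj i)) (ancestor (g-adj j))
      (FinP.fromℕ<-injective _ _ (depth<c (g-adj i)) (depth<c (g-adj j)) eq))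
  where
  ancestor : ∀ {u} → Edge G u v → Ancestor par u v
  ancestor {u} e with comparable u v e
  ... | inj₁ u≺v = u≺v
  ... | inj₂ v≺u = ⊥-elim (ℕP.<⇒≱ (Ancestor⇒depth< depth-child v≺u) (deepest u))
  depth<c : ∀ {u} → Edge G u v → depth u < c
  depth<c e = ℕP.<-≤-trans (Ancestor⇒depth< depth-child (ancestor e)) (proj₂ (bounds v))

Covering : Graph n → (Fin r → Subset n) → Set
Covering G bag = (∀ v → ∃[ t ] v ∈ bag t) × (∀ u v → Edge G u v → ∃[ t ] (u ∈ bag t × v ∈ bag t))

ClosedNbhdInBag : Graph n → (Fin r → Subset n) → Set
ClosedNbhdInBag G bag = ∃[ v ] ∃[ t ] (v ∈ bag t × (∀ u → Edge G u v → u ∈ bag t))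

⊆⊎∃∉ : (p q : Subset n) → p ⊆ q ⊎ ∃[ x ] (x ∈ p × x ∉ q)
⊆⊎∃∉ p q with FinP.any? (λ x → x ∈? p ×-dec ¬? (x ∈? q))
... | yes witness = inj₂ witness
... | no ¬witness = inj₁ λ {x} x∈p → decidable-stable (x ∈? q) λ x∉q → ¬witness (x , x∈p , x∉q)

data PunchInView (ℓ : Fin (suc r)) : Fin (suc r) → Set where
  at      : PunchInView ℓ ℓ
  punched : ∀ i → PunchInView ℓ (punchIn ℓ i)

punchInView : ∀ (ℓ t : Fin (suc r)) → PunchInView ℓ t
punchInView ℓ t with t ≟ ℓ
... | yes refl = at
... | no t≢ℓ = ≡.subst (PunchInView ℓ) (FinP.punchIn-punchOut (t≢ℓ ∘ ≡.sym)) (punched _)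

closedNbhd-singleBag : (G : Graph n) (bag : Fin 1 → Subset n) → Fin n → Covering G bag → ClosedNbhdInBag G bag
closedNbhd-singleBag G bag v (covers-vertices , covers-edges) with covers-vertices v
... | zero , v∈bag = v , zero , v∈bag , λ u e → in-the-bag (covers-edges u v e)
  where
  in-the-bag : ∀ {u} → ∃[ t ] (u ∈ bag t × v ∈ bag t) → u ∈ bag zero
  in-the-bag (zero , u∈bag , _) = u∈bag

-- Either bag ℓ ⊆ bag (punchIn ℓ q) and bag ℓ can be dropped, or some vertex of bag ℓ lies in no
-- other bag, and then so does its closed neighbourhood.
closedNbhd-peel : (G : Graph n) (bag : Fin (suc r) → Subset n) (ℓ : Fin (suc r)) (q : Fin r) →
  (∀ {v t} → v ∈ bag ℓ → v ∈ bag t → t ≢ ℓ → v ∈ bag (punchIn ℓ q)) →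
  Covering G bag →
  (Covering G (bag ∘ punchIn ℓ) → ClosedNbhdInBag G (bag ∘ punchIn ℓ)) →
  ClosedNbhdInBag G bag
closedNbhd-peel G bag ℓ q separates (covers-vertices , covers-edges) recurse
  with ⊆⊎∃∉ (bag ℓ) (bag (punchIn ℓ q))
... | inj₁ ℓ⊆q =
  lift (recurse ((λ v → relocate (covers-vertices v)) , λ u v e → relocate₂ (covers-edges u v e)))
  where
  into-punched : ∀ t → ∃[ t′ ] (bag t ⊆ bag (punchIn ℓ t′))
  into-punched t with punchInView ℓ t
  ... | at = q , ℓ⊆q
  ... | punched t′ = t′ , id
  relocate : ∀ {v} → ∃[ t ] v ∈ bag t → ∃[ t ] v ∈ bag (punchIn ℓ t)
  relocate (t , v∈t) = let t′ , ⊆t′ = into-punched t in t′ , ⊆t′ v∈t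
  relocate₂ : ∀ {u v} → ∃[ t ] (u ∈ bag t × v ∈ bag t) →
    ∃[ t ] (u ∈ bag (punchIn ℓ t) × v ∈ bag (punchIn ℓ t))
  relocate₂ (t , u∈t , v∈t) = let t′ , ⊆t′ = into-punched t in t′ , ⊆t′ u∈t , ⊆t′ v∈t
  lift : ClosedNbhdInBag G (bag ∘ punchIn ℓ) → ClosedNbhdInBag G bag
  lift (v , t , v∈t , nbhd⊆t) = v , punchIn ℓ t , v∈t , nbhd⊆t
... | inj₂ (v , v∈ℓ , v∉q) = v , ℓ , v∈ℓ , nbhd⊆ℓ
  where
  nbhd⊆ℓ : ∀ u → Edge G u v → u ∈ bag ℓ
  nbhd⊆ℓ u e with covers-edges u v e
  ... | t , u∈t , v∈t with t ≟ ℓ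
  ...   | yes refl = u∈t
  ...   | no t≢ℓ = ⊥-elim (v∉q (separates v∈ℓ v∈t t≢ℓ))

Interval : (Fin r → Subset n) → Set
Interval {r} {n} bag =
  ∀ (v : Fin n) (i j k : Fin r) → i Fin.≤ j → j Fin.≤ k → v ∈ bag i → v ∈ bag k → v ∈ bag j

closedNbhd-path : (G : Graph n) (bag : Fin (suc r) → Subset n) → Fin n →
  Interval bag → Covering G bag → ClosedNbhdInBag G bag
closedNbhd-path {r = zero} G bag v₀ _ covers = closedNbhd-singleBag G bag v₀ covers
closedNbhd-path {r = suc r} G bag v₀ interval covers =
  closedNbhd-peel G bag last (fromℕ r) separates covers (closedNbhd-path G (bag ∘ punchIn last) v₀ interval′)
  where
  last = fromℕ (suc r)
  interval′ : Interval (bag ∘ punchIn last)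
  interval′ v i j k i≤j j≤k =
    interval v _ _ _ (FinP.punchIn-mono-≤ last i j i≤j) (FinP.punchIn-mono-≤ last j k j≤k)
  separates : ∀ {v t} → v ∈ bag last → v ∈ bag t → t ≢ last → v ∈ bag (punchIn last (fromℕ r))
  separates {v} {t} v∈last v∈t t≢last with punchInView last t
  ... | at = ⊥-elim (t≢last refl)
  ... | punched i =
    interval v _ _ last (FinP.punchIn-mono-≤ last i _ (FinP.≤fromℕ i)) (FinP.≤fromℕ _) v∈t v∈last

PwLe⇒DegreeLe : (G : Graph n) {c : ℕ} → Fin n → PwLe G c → ∃[ v ] DegreeLe G v c
PwLe⇒DegreeLe G v₀ (zero , _ , covers-vertices , _) with covers-vertices v₀
... | () , _
PwLe⇒DegreeLe G v₀ (suc r , bag , covers-vertices , covers-edges , interval , small)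
  with closedNbhd-path G bag v₀ interval (covers-vertices , covers-edges)
... | v , t , v∈t , nbhd⊆t = v , closedNbhd⇒DegreeLe G v∈t nbhd⊆t (small t)

-- For trees, connectivity of the vertex sets is used in the form "every 2-colouring of the nodes
-- that splits S has a bichromatic edge inside S", which unlike walks survives deleting a leaf.
CrossingEdge : Graph r → (Fin r → Set) → (Fin r → Bool) → Set
CrossingEdge T S X = ∃[ a ] ∃[ b ] (S a × S b × X a ≡ true × X b ≡ false × Edge T a b)

CutConnected : Graph r → (Fin r → Set) → Set
CutConnected {r} T S =
  ∀ (X : Fin r → Bool) {u v} → S u → S v → X u ≡ true → X v ≡ false → CrossingEdge T S X

walk⇒CrossingEdge : (T : Graph r) (S : Fin r → Set) (X : Fin r → Bool) (k : ℕ) (w : Fin (suc k) → Fin r) →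
  (∀ i → Edge T (w (inject₁ i)) (w (suc i))) → (∀ i → S (w i)) →
  X (w zero) ≡ true → X (w (fromℕ k)) ≡ false → CrossingEdge T S X
walk⇒CrossingEdge T S X zero w _ _ start end with ≡.trans (≡.sym start) end
... | ()
walk⇒CrossingEdge T S X (suc k) w edges inS start end with X (w (suc zero)) in second
... | false = w zero , w (suc zero) , inS zero , inS (suc zero) , start , second , edges zero
... | true  = walk⇒CrossingEdge T S X k (w ∘ suc) (edges ∘ suc) (inS ∘ suc) second end

ConnectedSet⇒CutConnected : (T : Graph r) (S : Fin r → Set) → ConnectedSet T S → CutConnected T S
ConnectedSet⇒CutConnected T S connected X su sv Xu Xv with connected _ _ su sv
... | k , w , refl , refl , edges , inS = walk⇒CrossingEdge T S X k w edges inS Xu Xv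

delete : Graph (suc r) → Fin (suc r) → Graph r
delete T ℓ = record
  { adj = λ i j → adj T (punchIn ℓ i) (punchIn ℓ j)
  ; sym = λ i j → sym T _ _
  ; irrefl = λ i → irrefl T _
  }

Cycle-delete : (T : Graph (suc r)) (ℓ : Fin (suc r)) → Cycle (delete T ℓ) → Cycle T
Cycle-delete T ℓ (k , c , c-inj , edges , closing) =
  k , punchIn ℓ ∘ c , (λ eq → c-inj (FinP.punchIn-injective ℓ _ _ eq)) , edges , closing

-- ℓ may also be isolated.
Leaf : Graph (suc r) → Fin (suc r) → Fin r → Set
Leaf T ℓ q = ∀ x → Edge T ℓ x → x ≡ punchIn ℓ q

retract : Fin (suc r) → Fin r → Fin (suc r) → Fin r
retract ℓ q t with t ≟ ℓ
... | yes _ = q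
... | no t≢ℓ = punchOut (t≢ℓ ∘ ≡.sym)

retract-punchIn : ∀ (ℓ : Fin (suc r)) q i → retract ℓ q (punchIn ℓ i) ≡ i
retract-punchIn ℓ q i with punchIn ℓ i ≟ ℓ
... | yes eq = ⊥-elim (FinP.punchInᵢ≢i ℓ i eq)
... | no _ = ≡.trans (FinP.punchOut-cong ℓ refl) (FinP.punchOut-punchIn ℓ)

retract-identifies : ∀ (ℓ : Fin (suc r)) q → retract ℓ q ℓ ≡ retract ℓ q (punchIn ℓ q)
retract-identifies ℓ q with ℓ ≟ ℓ
... | yes _ = ≡.sym (retract-punchIn ℓ q q)
... | no ℓ≢ℓ = ⊥-elim (ℓ≢ℓ refl)

bichromatic : ∀ {x y : Bool} → x ≡ true → y ≡ false → x ≢ y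
bichromatic refl refl ()

Leaf-separates : (T : Graph (suc r)) {ℓ : Fin (suc r)} {q : Fin r} {S : Fin (suc r) → Set} →
  Leaf T ℓ q → CutConnected T S → S ℓ → ∀ {t} → S t → t ≢ ℓ → S (punchIn ℓ q)
Leaf-separates T {ℓ} {q} {S} leaf connected sℓ st t≢ℓ
  with connected (λ x → does (x ≟ ℓ)) sℓ st (dec-true (ℓ ≟ ℓ) refl) (dec-false (_ ≟ ℓ) t≢ℓ)
... | a , b , _ , sb , Xa , _ , e with a ≟ ℓ
...   | yes refl = ≡.subst S (leaf b e) sb
...   | no _ = case Xa of λ ()

CutConnected-delete : (T : Graph (suc r)) {ℓ : Fin (suc r)} {q : Fin r} {S : Fin (suc r) → Set} →
  Leaf T ℓ q → CutConnected T S → CutConnected (delete T ℓ) (S ∘ punchIn ℓ)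
CutConnected-delete T {ℓ} {q} leaf connected X su sv Xu Xv
  with connected (X ∘ retract ℓ q) su sv (≡.trans (≡.cong X (retract-punchIn ℓ q _)) Xu)
                                          (≡.trans (≡.cong X (retract-punchIn ℓ q _)) Xv)
... | a , b , sa , sb , Xa , Xb , e with punchInView ℓ a | punchInView ℓ b
...   | at | _ = ⊥-elim (bichromatic Xa Xb
          (≡.cong X (≡.trans (retract-identifies ℓ q) (≡.cong (retract ℓ q) (≡.sym (leaf b e))))))
...   | punched _ | at = ⊥-elim (bichromatic Xa Xb
          (≡.cong X (≡.trans (≡.cong (retract ℓ q) (leaf _ (Edge-sym T e)))
                             (≡.sym (retract-identifies ℓ q)))))
...   | punched i | punched j = i , j , sa , sb ,
          ≡.trans (≡.cong X (≡.sym (retract-punchIn ℓ q i))) Xa ,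
          ≡.trans (≡.cong X (≡.sym (retract-punchIn ℓ q j))) Xb , e

record Path (T : Graph r) (k : ℕ) : Set where
  field
    vertex      : Fin (suc k) → Fin r
    distinct    : Injective _≡_ _≡_ vertex
    consecutive : ∀ (i : Fin k) → Edge T (vertex (inject₁ i)) (vertex (suc i))

open Path

module _ (T : Graph r) where

  Path-init : ∀ {k} → Path T (suc k) → Path T k
  Path-init P = record
    { vertex = vertex P ∘ inject₁
    ; distinct = FinP.inject₁-injective ∘ distinct P
    ; consecutive = consecutive P ∘ inject₁
    }

  Path-cons : ∀ {k} (y : Fin r) (P : Path T k) →
    Edge T y (vertex P zero) → (∀ i → vertex P i ≢ y) → Path T (suc k)
  Path-cons y P e fresh =
    record { vertex = y ∷ vertex P ; distinct = cons-distinct ; consecutive = cons-consecutive }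
    where
    cons-distinct : Injective _≡_ _≡_ (y ∷ vertex P)
    cons-distinct {zero} {zero} _ = refl
    cons-distinct {zero} {suc j} y≡ = ⊥-elim (fresh j (≡.sym y≡))
    cons-distinct {suc i} {zero} ≡y = ⊥-elim (fresh i ≡y)
    cons-distinct {suc i} {suc j} eq = ≡.cong suc (distinct P eq)
    cons-consecutive : ∀ i → Edge T ((y ∷ vertex P) (inject₁ i)) ((y ∷ vertex P) (suc i))
    cons-consecutive zero = e
    cons-consecutive (suc i) = consecutive P i

  closed-Path⇒Cycle : ∀ {k} (P : Path T k) → 2 ≤ k → Edge T (vertex P (fromℕ k)) (vertex P zero) → Cycle T
  closed-Path⇒Cycle {suc zero} P (s≤s ()) _
  closed-Path⇒Cycle {suc (suc k)} P _ closing = k , vertex P , distinct P , consecutive P , closing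

  last-or-inject₁ : ∀ {k} (i : Fin (suc k)) → i ≡ fromℕ k ⊎ ∃[ j ] i ≡ inject₁ j
  last-or-inject₁ {zero} zero = inj₁ refl
  last-or-inject₁ {suc k} zero = inj₂ (zero , refl)
  last-or-inject₁ {suc k} (suc i) with last-or-inject₁ i
  ... | inj₁ refl = inj₁ refl
  ... | inj₂ (j , refl) = inj₂ (suc j , refl)

  chord⇒Cycle : ∀ {k} (P : Path T k) (i : Fin (suc k)) →
    2 ≤ toℕ i → Edge T (vertex P i) (vertex P zero) → Cycle T
  chord⇒Cycle {zero} P zero () chord
  chord⇒Cycle {suc k} P i 2≤i chord with last-or-inject₁ i
  ... | inj₁ refl = closed-Path⇒Cycle P (≡.subst (2 ≤_) (FinP.toℕ-fromℕ (suc k)) 2≤i) chord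
  ... | inj₂ (j , refl) = chord⇒Cycle (Path-init P) j (≡.subst (2 ≤_) (FinP.toℕ-inject₁ j) 2≤i) chord

  MaximalPath : Set
  MaximalPath = ∃[ k ] Σ (Path T k) λ P → ∀ y → Edge T (vertex P zero) y → ∃[ i ] vertex P i ≡ y

  extend : ∀ fuel {k} → r ≤ k + fuel → Path T k → MaximalPath
  extend zero {k} r≤k P =
    ⊥-elim (ℕP.<-irrefl refl
      (ℕP.≤-trans (FinP.injective⇒≤ (distinct P)) (≡.subst (r ≤_) (ℕP.+-identityʳ k) r≤k)))
  extend (suc fuel) {k} r≤ P
    with FinP.any? (λ y → (adj T (vertex P zero) y Bool.≟ true) ×-dec ¬? (FinP.any? (λ i → vertex P i ≟ y)))
  ... | yes (y , e , fresh) =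
    extend fuel (≡.subst (r ≤_) (ℕP.+-suc k fuel) r≤) (Path-cons y P (Edge-sym T e) λ i eq → fresh (i , eq))
  ... | no stuck =
    k , P , λ y e → decidable-stable (FinP.any? (λ i → vertex P i ≟ y)) λ ¬on → stuck (y , e , ¬on)

-- The first vertex of a maximal path is a leaf, since a further neighbour on the path would close a cycle.
acyclic⇒Leaf : (T : Graph (suc (suc r))) → ¬ Cycle T → ∃[ ℓ ] ∃[ q ] Leaf T ℓ q
acyclic⇒Leaf {r} T acyclic with extend T (suc (suc r)) {0} ℕP.≤-refl start
  where
  start : Path T 0
  start = record { vertex = const zero ; distinct = λ { {zero} {zero} _ → refl } ; consecutive = λ () }
... | zero , P , maximal = vertex P zero , zero , λ x e → ⊥-elim (isolated x e)
  where
  isolated : ∀ x → ¬ Edge T (vertex P zero) x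
  isolated x e with maximal x e
  ... | zero , refl = Edge-irrefl T e refl
... | suc k , P , maximal = vertex P zero , punchOut p₀≢p₁ , neighbour
  where
  p₀≢p₁ : vertex P zero ≢ vertex P (suc zero)
  p₀≢p₁ eq = FinP.0≢1+n (distinct P eq)
  neighbour : Leaf T (vertex P zero) (punchOut p₀≢p₁)
  neighbour x e with maximal x e
  ... | zero , refl = ⊥-elim (Edge-irrefl T e refl)
  ... | suc zero , refl = ≡.sym (FinP.punchIn-punchOut p₀≢p₁)
  ... | suc (suc j) , refl = ⊥-elim (acyclic (chord⇒Cycle T P (suc (suc j)) (s≤s (s≤s z≤n)) (Edge-sym T e)))

closedNbhd-tree : (G : Graph n) (T : Graph (suc r)) (bag : Fin (suc r) → Subset n) → Fin n → ¬ Cycle T →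
  (∀ v → CutConnected T (λ t → v ∈ bag t)) → Covering G bag → ClosedNbhdInBag G bag
closedNbhd-tree {r = zero} G T bag v₀ _ _ covers = closedNbhd-singleBag G bag v₀ covers
closedNbhd-tree {r = suc r} G T bag v₀ acyclic connected covers with acyclic⇒Leaf T acyclic
... | ℓ , q , leaf =
  closedNbhd-peel G bag ℓ q (λ {v} v∈ℓ v∈t → Leaf-separates T leaf (connected v) v∈ℓ v∈t) covers
    (closedNbhd-tree G (delete T ℓ) (bag ∘ punchIn ℓ) v₀ (acyclic ∘ Cycle-delete T ℓ)
      (λ v → CutConnected-delete T leaf (connected v)))

TwLe⇒DegreeLe : (G : Graph n) {c : ℕ} → Fin n → TwLe G c → ∃[ v ] DegreeLe G v c
TwLe⇒DegreeLe G v₀ (suc r , T , bag , (_ , _ , acyclic) , covers-vertices , covers-edges , connected , small)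
  with closedNbhd-tree G T bag v₀ acyclic (λ v → ConnectedSet⇒CutConnected T _ (connected v))
                        (covers-vertices , covers-edges)
... | v , t , v∈t , nbhd⊆t = v , closedNbhd⇒DegreeLe G v∈t nbhd⊆t (small t)

ParamLe⇒DegreeLe : ∀ p (G : Graph n) {c : ℕ} → Fin n → ParamLe p G c → ∃[ v ] DegreeLe G v c
ParamLe⇒DegreeLe {suc _} treedepth G _ = TdLe⇒DegreeLe G
ParamLe⇒DegreeLe pathwidth G = PwLe⇒DegreeLe G
ParamLe⇒DegreeLe treewidth G = TwLe⇒DegreeLe G

minDegree⇒¬ParamLe : ∀ p (G : Graph n) {c : ℕ} → Fin n → (∀ v → Neighbours G v (suc c)) → ¬ ParamLe p G c
minDegree⇒¬ParamLe p G v₀ neighbours bounded with ParamLe⇒DegreeLe p G v₀ bounded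
... | v , degree≤c = ℕP.1+n≰n (degree≤c (neighbours v))

UnboundedMinDegree : Graph m → ℕ → Set
UnboundedMinDegree F d =
  ∀ c → ∃[ n ] Σ (Graph (suc n)) λ G → Free F G × DiamLe G d × (∀ v → Neighbours G v (suc c))

UnboundedMinDegree⇒¬Bounded : ∀ p {F : Graph m} {d : ℕ} → UnboundedMinDegree F d → ¬ BoundedOnFreeDiam p F d
UnboundedMinDegree⇒¬Bounded p family (c , bounded) with family c
... | n , G , free , diam , neighbours = minDegree⇒¬ParamLe p G zero neighbours (bounded (suc n) G free diam)

complete-graphs : {F : Graph m} {d : ℕ} → ¬ IsComplete F → 1 ≤ d → UnboundedMinDegree F d
complete-graphs {F = F} incomplete 1≤d c = suc c , K (suc (suc c)) ,
  (λ sub → incomplete (InducedSub-complete {F = F} {K (suc (suc c))} sub K-complete)) ,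
  DiamLe-mono (K (suc (suc c))) 1≤d (complete⇒DiamLe1 (K (suc (suc c))) K-complete) , K-neighbours (suc c)

complete-bipartite-graphs : {F : Graph m} {d : ℕ} → IsComplete F → 3 ≤ m → 2 ≤ d → UnboundedMinDegree F d
complete-bipartite-graphs {F = F} complete 3≤m 2≤d c = c + suc c , KB (suc c) ,
  KB-free (suc c) {F} complete 3≤m , DiamLe-mono (KB (suc c)) 2≤d (KB-DiamLe2 c) , KB-neighbours (suc c)

isComplete? : (F : Graph m) → Dec (IsComplete F)
isComplete? F = FinP.all? λ i → FinP.all? λ j → ¬? (i ≟ j) →-dec (adj F i j Bool.≟ true)

bounded⇒complete : ∀ p {F : Graph m} {d : ℕ} → 1 ≤ d → BoundedOnFreeDiam p F d → IsComplete F
bounded⇒complete p {F = F} 1≤d bounded = decidable-stable (isComplete? F) λ incomplete →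
  UnboundedMinDegree⇒¬Bounded p {F} (complete-graphs {F = F} incomplete 1≤d) bounded

bounded⇒order≤2 : ∀ p {F : Graph m} {d : ℕ} → IsComplete F → 2 ≤ d → BoundedOnFreeDiam p F d → m ≤ 2
bounded⇒order≤2 {m = m} p {F} complete 2≤d bounded = decidable-stable (m ℕP.≤? 2) λ m≰2 →
  UnboundedMinDegree⇒¬Bounded p {F} (complete-bipartite-graphs {F = F} complete (ℕP.≰⇒> m≰2) 2≤d) bounded

K≤2-free⇒complete : (G : Graph n) {F : Graph m} {d : ℕ} →
  IsComplete F → m ≤ 2 → Free F G → DiamLe G d → IsComplete G
K≤2-free⇒complete G {F} complete m≤2 free diam u v u≢v with distinct⇒edge G diam u≢v
... | _ , _ , e = ⊥-elim (free (edge⇒InducedSub {F = F} G complete m≤2 e))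

forced-complete⇒bounded : ∀ p {F : Graph m} {d : ℕ} → IsComplete F →
  (∀ {n} (G : Graph n) → Free F G → DiamLe G d → IsComplete G) → BoundedOnFreeDiam p F d
forced-complete⇒bounded {m = m} p {F} F-complete forced-complete = m , λ n G free diam →
  ParamLe-order p G (ℕP.<⇒≤ (complete-free⇒order< {F = F} G F-complete (forced-complete G free diam) free))

one-or-two : 1 ≤ m → m ≤ 2 → m ≡ 1 ⊎ m ≡ 2
one-or-two {suc zero} _ _ = inj₁ refl
one-or-two {suc (suc zero)} _ _ = inj₂ refl
one-or-two {suc (suc (suc _))} _ (s≤s (s≤s ()))

necessary : ∀ p {F : Graph m} {d : ℕ} → 1 ≤ m → 1 ≤ d → BoundedOnFreeDiam p F d →
  (d ≡ 1 × IsComplete F) ⊎ (2 ≤ d × IsComplete F × (m ≡ 1 ⊎ m ≡ 2))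
necessary p {F} 1≤m 1≤d bounded with bounded⇒complete p {F} 1≤d bounded | ℕP.m≤n⇒m<n∨m≡n 1≤d
... | complete | inj₂ refl = inj₁ (refl , complete)
... | complete | inj₁ 2≤d =
  inj₂ (2≤d , complete , one-or-two 1≤m (bounded⇒order≤2 p {F} complete 2≤d bounded))

sufficient : ∀ p {F : Graph m} {d : ℕ} →
  (d ≡ 1 × IsComplete F) ⊎ (2 ≤ d × IsComplete F × (m ≡ 1 ⊎ m ≡ 2)) → BoundedOnFreeDiam p F d
sufficient p {F} (inj₁ (refl , complete)) = forced-complete⇒bounded p {F} complete λ G _ → DiamLe1⇒complete G
sufficient p {F} (inj₂ (_ , complete , m≡1⊎m≡2)) =
  forced-complete⇒bounded p {F} complete λ G → K≤2-free⇒complete G {F} complete (order≤2 m≡1⊎m≡2)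
  where
  order≤2 : m ≡ 1 ⊎ m ≡ 2 → m ≤ 2
  order≤2 (inj₁ refl) = s≤s z≤n
  order≤2 (inj₂ refl) = ℕP.≤-refl

theorem5 : ∀ {m} (F : Graph m) → 1 ≤ m → (d : ℕ) → 1 ≤ d → (p : Param) →
    BoundedOnFreeDiam p F d ⇔
      ((d ≡ 1 × IsComplete F) ⊎ (2 ≤ d × IsComplete F × (m ≡ 1 ⊎ m ≡ 2)))
theorem5 F 1≤m d 1≤d p = mk⇔ (necessary p {F} 1≤m 1≤d) (sufficient p {F})
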